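{- Let $p$ be a prime, let $A$ be a matrix over $GF(p)$ whose columns are labelled by a finite set $E$, and let $M=M[A]$. Let $a,b\in E$ be distinct, $\alpha\in GF(p)\setminus\{0\}$, and let $M_{a,b}$ be the splitting matroid. If $C_1$ and $C_2$ are disjoint $np$-circuits of $M$ with $a\in C_1$ and $b\in C_2$, then $C_1\cup C_2$ is a dependent set of $M_{a,b}$.
   Context: The splitting matroid $M_{a,b}$ is the vector matroid $M[A_{a,b}]$, where $A_{a,b}$ is obtained from $A$ by appending one extra row with entries $\alpha$ in the columns $a$ and $b$ and $0$ elsewhere. For a circuit $C$ of $M$, the columns $u\in C$ satisfy a linear relation $\sum_{u\in C}c_u u=0$ over $GF(p)$ with all $c_u\neq 0$; this relation is unique up to a nonzero scalar, and $c_u$ is called the coefficient of $u$. A circuit $C$ of $M$ is a $p$-circuit if $a,b\in C$ and $c_a+c_b=0$ in $GF(p)$; it is an $np$-circuit if either $|C\cap\{a,b\}|=1$, or $a,b\in C$ and $c_a+c_b\neq 0$. -}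

module Defs where

open import Data.Nat using (ℕ; zero; suc; _+_; _*_)
open import Data.Nat.Divisibility using (_∣_)
open import Data.Fin using (Fin; zero; suc)
open import Data.Fin.Subset using (Subset; _∈_; _∉_; _⊂_)
open import Data.Product using (Σ; ∃; _×_)
open import Data.Sum using (_⊎_)
open import Relation.Nullary using (¬_; Dec; yes; no)
open import Relation.Binary.PropositionalEquality using (_≡_)
import Data.Fin as F

-- GF(p) is modelled as ℕ modulo p: an element x : ℕ is zero in GF(p)
-- iff p ∣ x.  All arithmetic below is ℕ-arithmetic read modulo p.

Matrix : ℕ → ℕ → Set
Matrix m n = Fin m → Fin n → ℕ

Σ[<_] : (n : ℕ) → (Fin n → ℕ) → ℕ
Σ[< zero ] f = 0
Σ[< suc n ] f = f zero + Σ[< n ] (λ i → f (suc i))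

IsRelation : (p : ℕ) {m n : ℕ} → Matrix m n → (Fin n → ℕ) → Set
IsRelation p {m} {n} A c = ∀ (i : Fin m) → p ∣ Σ[< n ] (λ u → c u * A i u)

SupportedIn : (p : ℕ) {n : ℕ} → (Fin n → ℕ) → Subset n → Set
SupportedIn p c X = ∀ u → u ∉ X → p ∣ c u

Dependent : (p : ℕ) {m n : ℕ} → Matrix m n → Subset n → Set
Dependent p A X = Σ _ λ c → IsRelation p A c × SupportedIn p c X
                              × ∃ λ u → u ∈ X × ¬ (p ∣ c u)

Circuit : (p : ℕ) {m n : ℕ} → Matrix m n → Subset n → Set
Circuit p {m} {n} A C = Dependent p A C × (∀ (D : Subset n) → D ⊂ C → ¬ Dependent p A D)

-- c is a linear relation whose coefficients are nonzero exactly on C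
-- (for a circuit C this relation is unique up to a nonzero scalar)
CircuitRelation : (p : ℕ) {m n : ℕ} → Matrix m n → Subset n → (Fin n → ℕ) → Set
CircuitRelation p A C c = IsRelation p A c × SupportedIn p c C
                          × (∀ u → u ∈ C → ¬ (p ∣ c u))

NPCircuit : (p : ℕ) {m n : ℕ} → Matrix m n → Fin n → Fin n → Subset n → Set
NPCircuit p A a b C =
  Circuit p A C ×
  ( (a ∈ C × b ∉ C)
  ⊎ (a ∉ C × b ∈ C)
  ⊎ (a ∈ C × b ∈ C × Σ _ λ c → CircuitRelation p A C c × ¬ (p ∣ (c a + c b))) )

splitRow : {n : ℕ} → Fin n → Fin n → ℕ → Fin n → ℕ
splitRow a b α u with a F.≟ u | b F.≟ u
... | yes _ | _     = α
... | no _  | yes _ = α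
... | no _  | no _  = 0

-- A_{a,b}: A with the extra row (placed as row 0; row order is irrelevant
-- for the vector matroid)
splitMatrix : {m n : ℕ} → Matrix m n → Fin n → Fin n → ℕ → Matrix (suc m) n
splitMatrix A a b α zero    = splitRow a b α
splitMatrix A a b α (suc i) = A i

{-# OPTIONS --safe #-}
-- A relation c of A is a relation of A_{a,b} exactly when (c a + c b)·α = 0.
-- Take relations c of C₁ and d of C₂; as b ∉ C₁ and a ∉ C₂, the extra row
-- sees only c a and d b.  If one of these vanishes that relation already
-- works; otherwise d b · c − c a · d kills the extra row, and it is nonzero
-- at a because c a ≠ 0, d a = 0 and GF(p) has no zero divisors.
module Submission where

open import Defs
open import Data.Nat using (ℕ; zero; suc; _+_; _*_)
open import Data.Nat.Properties using (+-identityʳ; +-comm; *-zeroʳ; *-distribʳ-+; *-distribˡ-+)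
open import Data.Nat.Divisibility
  using (_∣_; _∣?_; ∣m∣n⇒∣m+n; ∣m+n∣m⇒∣n; ∣n⇒∣m*n; ∣m⇒∣m*n; m∣m*n)
open import Data.Nat.Primality using (Prime; euclidsLemma)
open import Data.Nat.Tactic.RingSolver using (solve-∀)
open import Data.Fin using (Fin; zero; suc)
import Data.Fin as F
open import Data.Fin.Properties using (suc-injective)
open import Data.Fin.Subset using (Subset; _∈_; _∉_; _⊆_; _∪_)
open import Data.Fin.Subset.Properties using (p⊆p∪q; q⊆p∪q; _∈?_)
open import Data.Product using (_,_)
open import Data.Sum using (inj₁; inj₂)
open import Data.Empty using (⊥-elim)
open import Relation.Nullary using (¬_; yes; no)
open import Relation.Binary.PropositionalEquality

private
  variable
    p n : ℕ

Σ-cong : {f g : Fin n → ℕ} → (∀ u → f u ≡ g u) → Σ[< n ] f ≡ Σ[< n ] g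
Σ-cong {zero}  f≗g = refl
Σ-cong {suc n} f≗g = cong₂ _+_ (f≗g zero) (Σ-cong (λ u → f≗g (suc u)))

Σ-+ : (f g : Fin n → ℕ) → Σ[< n ] (λ u → f u + g u) ≡ Σ[< n ] f + Σ[< n ] g
Σ-+ {zero}  f g = refl
Σ-+ {suc n} f g = begin
  (f zero + g zero) + Σ[< n ] (λ u → f (suc u) + g (suc u))
    ≡⟨ cong ((f zero + g zero) +_) (Σ-+ (λ u → f (suc u)) (λ u → g (suc u))) ⟩
  (f zero + g zero) + (Σ[< n ] (λ u → f (suc u)) + Σ[< n ] (λ u → g (suc u)))
    ≡⟨ interchange (f zero) (g zero) _ _ ⟩
  (f zero + Σ[< n ] (λ u → f (suc u))) + (g zero + Σ[< n ] (λ u → g (suc u))) ∎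
  where
  open ≡-Reasoning
  interchange : ∀ w x y z → (w + x) + (y + z) ≡ (w + y) + (x + z)
  interchange = solve-∀

Σ-*ˡ : (x : ℕ) (f : Fin n → ℕ) → Σ[< n ] (λ u → x * f u) ≡ x * Σ[< n ] f
Σ-*ˡ {zero}  x f = sym (*-zeroʳ x)
Σ-*ˡ {suc n} x f =
  trans (cong (x * f zero +_) (Σ-*ˡ x (λ u → f (suc u))))
        (sym (*-distribˡ-+ x (f zero) _))

Σ-zero : (f : Fin n → ℕ) → (∀ u → f u ≡ 0) → Σ[< n ] f ≡ 0
Σ-zero {zero}  f f≗0 = refl
Σ-zero {suc n} f f≗0 rewrite f≗0 zero = Σ-zero _ (λ u → f≗0 (suc u))

Σ-supported-at : (f : Fin n → ℕ) (a : Fin n) →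
  (∀ u → a ≢ u → f u ≡ 0) → Σ[< n ] f ≡ f a
Σ-supported-at f zero vanish =
  trans (cong (f zero +_) (Σ-zero _ (λ u → vanish (suc u) (λ ()))))
        (+-identityʳ _)
Σ-supported-at f (suc a) vanish rewrite vanish zero (λ ()) =
  Σ-supported-at _ a (λ u a≢u → vanish (suc u) (λ e → a≢u (suc-injective e)))

Σ-supported-at₂ : (f : Fin n → ℕ) (a b : Fin n) → a ≢ b →
  (∀ u → a ≢ u → b ≢ u → f u ≡ 0) → Σ[< n ] f ≡ f a + f b
Σ-supported-at₂ f zero    zero    a≢b vanish = ⊥-elim (a≢b refl)
Σ-supported-at₂ f zero    (suc b) a≢b vanish =
  cong (f zero +_)
    (Σ-supported-at _ b (λ u b≢u → vanish (suc u) (λ ()) (λ e → b≢u (suc-injective e))))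
Σ-supported-at₂ f (suc a) zero    a≢b vanish =
  trans (cong (f zero +_)
          (Σ-supported-at _ a (λ u a≢u → vanish (suc u) (λ e → a≢u (suc-injective e)) (λ ()))))
        (+-comm (f zero) _)
Σ-supported-at₂ f (suc a) (suc b) a≢b vanish rewrite vanish zero (λ ()) (λ ()) =
  Σ-supported-at₂ _ a b (λ e → a≢b (cong suc e))
    (λ u a≢u b≢u → vanish (suc u) (λ e → a≢u (suc-injective e)) (λ e → b≢u (suc-injective e)))

splitRow-at-a : (a b : Fin n) (α : ℕ) → splitRow a b α a ≡ α
splitRow-at-a a b α with a F.≟ a
... | yes _   = refl
... | no a≢a = ⊥-elim (a≢a refl)

splitRow-at-b : (a b : Fin n) (α : ℕ) → splitRow a b α b ≡ α
splitRow-at-b a b α with a F.≟ b | b F.≟ b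
... | yes _ | _       = refl
... | no _  | yes _   = refl
... | no _  | no b≢b = ⊥-elim (b≢b refl)

splitRow-elsewhere : (a b : Fin n) (α : ℕ) (u : Fin n) → a ≢ u → b ≢ u → splitRow a b α u ≡ 0
splitRow-elsewhere a b α u a≢u b≢u with a F.≟ u | b F.≟ u
... | yes a≡u | _       = ⊥-elim (a≢u a≡u)
... | no _    | yes b≡u = ⊥-elim (b≢u b≡u)
... | no _    | no _    = refl

Σ-*-splitRow : (a b : Fin n) → a ≢ b → (α : ℕ) (c : Fin n → ℕ) →
  Σ[< n ] (λ u → c u * splitRow a b α u) ≡ (c a + c b) * α
Σ-*-splitRow a b a≢b α c = begin
  Σ[< _ ] (λ u → c u * splitRow a b α u)
    ≡⟨ Σ-supported-at₂ _ a b a≢b (λ u a≢u b≢u →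
         trans (cong (c u *_) (splitRow-elsewhere a b α u a≢u b≢u)) (*-zeroʳ (c u))) ⟩
  c a * splitRow a b α a + c b * splitRow a b α b
    ≡⟨ cong₂ _+_ (cong (c a *_) (splitRow-at-a a b α)) (cong (c b *_) (splitRow-at-b a b α)) ⟩
  c a * α + c b * α
    ≡⟨ *-distribʳ-+ α (c a) (c b) ⟨
  (c a + c b) * α ∎
  where open ≡-Reasoning

IsRelation-linear : {p m n : ℕ} (A : Matrix m n) (x y : ℕ) {c d : Fin n → ℕ} →
  IsRelation p A c → IsRelation p A d → IsRelation p A (λ u → x * c u + y * d u)
IsRelation-linear {p = p} {n = n} A x y {c} {d} c-rel d-rel i =
  subst (p ∣_) (sym expand) (∣m∣n⇒∣m+n (∣n⇒∣m*n x (c-rel i)) (∣n⇒∣m*n y (d-rel i)))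
  where
  open ≡-Reasoning
  distrib : ∀ x y c d e → (x * c + y * d) * e ≡ x * (c * e) + y * (d * e)
  distrib = solve-∀
  expand : Σ[< n ] (λ u → (x * c u + y * d u) * A i u)
         ≡ x * Σ[< n ] (λ u → c u * A i u) + y * Σ[< n ] (λ u → d u * A i u)
  expand = begin
    Σ[< n ] (λ u → (x * c u + y * d u) * A i u)
      ≡⟨ Σ-cong (λ u → distrib x y (c u) (d u) (A i u)) ⟩
    Σ[< n ] (λ u → x * (c u * A i u) + y * (d u * A i u))
      ≡⟨ Σ-+ (λ u → x * (c u * A i u)) (λ u → y * (d u * A i u)) ⟩
    Σ[< n ] (λ u → x * (c u * A i u)) + Σ[< n ] (λ u → y * (d u * A i u))
      ≡⟨ cong₂ _+_ (Σ-*ˡ x (λ u → c u * A i u)) (Σ-*ˡ y (λ u → d u * A i u)) ⟩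
    x * Σ[< n ] (λ u → c u * A i u) + y * Σ[< n ] (λ u → d u * A i u) ∎

IsRelation-split : {p m n : ℕ} (A : Matrix m n) (a b : Fin n) → a ≢ b → (α : ℕ) (c : Fin n → ℕ) →
  IsRelation p A c → p ∣ c a + c b → IsRelation p (splitMatrix A a b α) c
IsRelation-split {p = p} A a b a≢b α c c-rel p∣ca+cb zero =
  subst (p ∣_) (sym (Σ-*-splitRow a b a≢b α c)) (∣m⇒∣m*n α p∣ca+cb)
IsRelation-split A a b a≢b α c c-rel p∣ca+cb (suc i) = c-rel i

SupportedIn-mono : {c : Fin n → ℕ} {X Y : Subset n} → X ⊆ Y → SupportedIn p c X → SupportedIn p c Y
SupportedIn-mono X⊆Y c-supp u u∉Y = c-supp u (λ u∈X → u∉Y (X⊆Y u∈X))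

Dependent-split : {p m n : ℕ} (A : Matrix m n) (a b : Fin n) → a ≢ b → (α : ℕ) {X : Subset n}
  (c : Fin n → ℕ) → IsRelation p A c → SupportedIn p c X → p ∣ c a + c b →
  (u : Fin n) → u ∈ X → ¬ (p ∣ c u) → Dependent p (splitMatrix A a b α) X
Dependent-split A a b a≢b α c c-rel c-supp p∣ca+cb u u∈X p∤cu =
  c , IsRelation-split A a b a≢b α c c-rel p∣ca+cb , c-supp , u , u∈X , p∤cu

-- In ℕ the scalar −1 of GF(p) is represented by q = p − 1.
Dependent-∪-split : {p m n : ℕ} → Prime p → (A : Matrix m n) (a b : Fin n) → a ≢ b → (α : ℕ)
  {X Y : Subset n} → Dependent p A X → Dependent p A Y → b ∉ X → a ∉ Y →
  Dependent p (splitMatrix A a b α) (X ∪ Y)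
Dependent-∪-split {zero} () _ _ _ _ _ _ _ _ _
Dependent-∪-split {p@(suc q)} {n = n} p-prime A a b a≢b α {X} {Y}
  (c , c-rel , c-supp , u , u∈X , p∤cu) (d , d-rel , d-supp , v , v∈Y , p∤dv) b∉X a∉Y
  with p ∣? c a | p ∣? d b
... | yes p∣ca | _ =
  Dependent-split A a b a≢b α c c-rel (SupportedIn-mono (p⊆p∪q Y) c-supp)
    (∣m∣n⇒∣m+n p∣ca (c-supp b b∉X)) u (p⊆p∪q Y u∈X) p∤cu
... | no _ | yes p∣db =
  Dependent-split A a b a≢b α d d-rel (SupportedIn-mono (q⊆p∪q X Y) d-supp)
    (∣m∣n⇒∣m+n (d-supp a a∉Y) p∣db) v (q⊆p∪q X Y v∈Y) p∤dv
... | no p∤ca | no p∤db =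
  Dependent-split A a b a≢b α e (IsRelation-linear A (d b) (q * c a) c-rel d-rel) e-supp
    p∣ea+eb a (p⊆p∪q Y a∈X) p∤ea
  where
  e : Fin n → ℕ
  e w = d b * c w + q * c a * d w

  a∈X : a ∈ X
  a∈X with a ∈? X
  ... | yes a∈X = a∈X
  ... | no  a∉X = ⊥-elim (p∤ca (c-supp a a∉X))

  e-supp : SupportedIn p e (X ∪ Y)
  e-supp w w∉X∪Y = ∣m∣n⇒∣m+n (∣n⇒∣m*n (d b) (c-supp w (λ w∈X → w∉X∪Y (p⊆p∪q Y w∈X))))
                             (∣n⇒∣m*n (q * c a) (d-supp w (λ w∈Y → w∉X∪Y (q⊆p∪q X Y w∈Y))))

  regroup : ∀ q ca cb da db → (db * ca + q * ca * da) + (db * cb + q * ca * db)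
                             ≡ suc q * (ca * db) + (q * ca * da + db * cb)
  regroup = solve-∀

  p∣ea+eb : p ∣ e a + e b
  p∣ea+eb = subst (p ∣_) (sym (regroup q (c a) (c b) (d a) (d b)))
    (∣m∣n⇒∣m+n (m∣m*n (c a * d b))
               (∣m∣n⇒∣m+n (∣n⇒∣m*n (q * c a) (d-supp a a∉Y)) (∣n⇒∣m*n (d b) (c-supp b b∉X))))

  p∤ea : ¬ (p ∣ e a)
  p∤ea p∣ea with euclidsLemma (d b) (c a) p-prime
                   (∣m+n∣m⇒∣n (subst (p ∣_) (+-comm (d b * c a) _) p∣ea)
                              (∣n⇒∣m*n (q * c a) (d-supp a a∉Y)))
  ... | inj₁ p∣db = p∤db p∣db
  ... | inj₂ p∣ca = p∤ca p∣ca

mainTheorem2 : (p : ℕ) → Prime p → (m n : ℕ) → (A : Matrix m n)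
    → (a b : Fin n) → a ≢ b → (α : ℕ) → ¬ (p ∣ α)
    → (C₁ C₂ : Subset n)
    → NPCircuit p A a b C₁ → NPCircuit p A a b C₂
    → (∀ u → u ∈ C₁ → u ∉ C₂)
    → a ∈ C₁ → b ∈ C₂
    → Dependent p (splitMatrix A a b α) (C₁ ∪ C₂)
mainTheorem2 p p-prime m n A a b a≢b α _ C₁ C₂ ((C₁-dep , _) , _) ((C₂-dep , _) , _)
  disjoint a∈C₁ b∈C₂ =
  Dependent-∪-split p-prime A a b a≢b α C₁-dep C₂-dep
    (λ b∈C₁ → disjoint b b∈C₁ b∈C₂) (disjoint a a∈C₁)
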